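{- The logic $\mathsf{CK}\oplus C_\Diamond\oplus I_{\Diamond\Box}$ is a conservative extension of $\mathsf{CK}_\Box$.
   Context: Formulas are built from a countably infinite set of propositional variables by $\varphi ::= p \mid \bot \mid \varphi\wedge\varphi \mid \varphi\vee\varphi \mid \varphi\to\varphi \mid \Box\varphi \mid \Diamond\varphi$. For a set $\mathsf{Ax}$ of formulas, $\mathsf{CK}\oplus\mathsf{Ax}$ is the consequence relation generated by: (Ax) $\Gamma\vdash\varphi$ whenever $\varphi$ is a substitution instance of an axiom of a standard Hilbert axiomatisation of intuitionistic propositional logic, of $\Box(p\to q)\to(\Box p\to\Box q)$, of $\Box(p\to q)\to(\Diamond p\to\Diamond q)$, or of a formula in $\mathsf{Ax}$; (El) $\Gamma\vdash\varphi$ if $\varphi\in\Gamma$; (MP) from $\Gamma\vdash\varphi$ and $\Gamma\vdash\varphi\to\psi$ infer $\Gamma\vdash\psi$; (Nec) from $\emptyset\vdash\varphi$ infer $\Gamma\vdash\Box\varphi$. $C_\Diamond$: $\Diamond(p\vee q)\to\Diamond p\vee\Diamond q$; $I_{\Diamond\Box}$: $(\Diamond p\to\Box q)\to\Box(p\to q)$. $\mathsf{CK}_\Box$ is the logic over $\Diamond$-free formulas axiomatised by intuitionistic propositional logic, $\Box(p\to q)\to(\Box p\to\Box q)$, modus ponens and necessitation. A logic is a conservative extension of $\mathsf{CK}_\Box$ if a $\Diamond$-free formula is derivable in it iff it is derivable in $\mathsf{CK}_\Box$. -}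

module Defs where

open import Data.Nat using (ℕ)
open import Data.Empty using (⊥)
open import Data.Product using (_×_)

infixr 5 _⇒_
infixl 6 _∨_
infixl 7 _∧_

data Fm : Set where
  var  : ℕ → Fm
  ⊥'   : Fm
  _∧_  : Fm → Fm → Fm
  _∨_  : Fm → Fm → Fm
  _⇒_  : Fm → Fm → Fm
  □    : Fm → Fm
  ◇    : Fm → Fm

sub : (ℕ → Fm) → Fm → Fm
sub σ (var n) = σ n
sub σ ⊥'      = ⊥'
sub σ (a ∧ b) = sub σ a ∧ sub σ b
sub σ (a ∨ b) = sub σ a ∨ sub σ b
sub σ (a ⇒ b) = sub σ a ⇒ sub σ b
sub σ (□ a)   = □ (sub σ a)
sub σ (◇ a)   = ◇ (sub σ a)

p q r : Fm
p = var 0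
q = var 1
r = var 2

data IPCAx : Fm → Set where
  ax-K    : IPCAx (p ⇒ q ⇒ p)
  ax-S    : IPCAx ((p ⇒ q ⇒ r) ⇒ (p ⇒ q) ⇒ p ⇒ r)
  ax-∧E₁  : IPCAx (p ∧ q ⇒ p)
  ax-∧E₂  : IPCAx (p ∧ q ⇒ q)
  ax-∧I   : IPCAx (p ⇒ q ⇒ p ∧ q)
  ax-∨I₁  : IPCAx (p ⇒ p ∨ q)
  ax-∨I₂  : IPCAx (q ⇒ p ∨ q)
  ax-∨E   : IPCAx ((p ⇒ r) ⇒ (q ⇒ r) ⇒ p ∨ q ⇒ r)
  ax-efq  : IPCAx (⊥' ⇒ p)

data CKAx : Fm → Set where
  ipc  : ∀ {a} → IPCAx a → CKAx a
  K□   : CKAx (□ (p ⇒ q) ⇒ □ p ⇒ □ q)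
  K◇   : CKAx (□ (p ⇒ q) ⇒ ◇ p ⇒ ◇ q)

∅ : Fm → Set
∅ _ = ⊥

data CK⊕ (Ax : Fm → Set) : (Fm → Set) → Fm → Set₁ where
  axCK  : ∀ {Γ a} (σ : ℕ → Fm) → CKAx a → CK⊕ Ax Γ (sub σ a)
  axExt : ∀ {Γ a} (σ : ℕ → Fm) → Ax a → CK⊕ Ax Γ (sub σ a)
  el    : ∀ {Γ φ} → Γ φ → CK⊕ Ax Γ φ
  mp    : ∀ {Γ φ ψ} → CK⊕ Ax Γ φ → CK⊕ Ax Γ (φ ⇒ ψ) → CK⊕ Ax Γ ψ
  nec   : ∀ {Γ φ} → CK⊕ Ax ∅ φ → CK⊕ Ax Γ (□ φ)

C◇ : Fm
C◇ = ◇ (p ∨ q) ⇒ ◇ p ∨ ◇ q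

I◇□ : Fm
I◇□ = (◇ p ⇒ □ q) ⇒ □ (p ⇒ q)

data C◇+I◇□ : Fm → Set where
  isC◇   : C◇+I◇□ C◇
  isI◇□  : C◇+I◇□ I◇□

data BFm : Set where
  bvar : ℕ → BFm
  b⊥   : BFm
  _b∧_ : BFm → BFm → BFm
  _b∨_ : BFm → BFm → BFm
  _b⇒_ : BFm → BFm → BFm
  b□   : BFm → BFm

emb : BFm → Fm
emb (bvar n) = var n
emb b⊥       = ⊥'
emb (a b∧ b) = emb a ∧ emb b
emb (a b∨ b) = emb a ∨ emb b
emb (a b⇒ b) = emb a ⇒ emb b
emb (b□ a)   = □ (emb a)

bsub : (ℕ → BFm) → BFm → BFm
bsub σ (bvar n) = σ n
bsub σ b⊥       = b⊥
bsub σ (a b∧ b) = bsub σ a b∧ bsub σ b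
bsub σ (a b∨ b) = bsub σ a b∨ bsub σ b
bsub σ (a b⇒ b) = bsub σ a b⇒ bsub σ b
bsub σ (b□ a)   = b□ (bsub σ a)

data CKBoxAx : BFm → Set where
  bax-K    : CKBoxAx (bvar 0 b⇒ (bvar 1 b⇒ bvar 0))
  bax-S    : CKBoxAx ((bvar 0 b⇒ (bvar 1 b⇒ bvar 2)) b⇒ ((bvar 0 b⇒ bvar 1) b⇒ (bvar 0 b⇒ bvar 2)))
  bax-∧E₁  : CKBoxAx ((bvar 0 b∧ bvar 1) b⇒ bvar 0)
  bax-∧E₂  : CKBoxAx ((bvar 0 b∧ bvar 1) b⇒ bvar 1)
  bax-∧I   : CKBoxAx (bvar 0 b⇒ (bvar 1 b⇒ (bvar 0 b∧ bvar 1)))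
  bax-∨I₁  : CKBoxAx (bvar 0 b⇒ (bvar 0 b∨ bvar 1))
  bax-∨I₂  : CKBoxAx (bvar 1 b⇒ (bvar 0 b∨ bvar 1))
  bax-∨E   : CKBoxAx ((bvar 0 b⇒ bvar 2) b⇒ ((bvar 1 b⇒ bvar 2) b⇒ ((bvar 0 b∨ bvar 1) b⇒ bvar 2)))
  bax-efq  : CKBoxAx (b⊥ b⇒ bvar 0)
  bax-K□   : CKBoxAx (b□ (bvar 0 b⇒ bvar 1) b⇒ (b□ (bvar 0) b⇒ b□ (bvar 1)))

data CK□⊢ : BFm → Set where
  bax : ∀ {a} (σ : ℕ → BFm) → CKBoxAx a → CK□⊢ (bsub σ a)
  bmp : ∀ {φ ψ} → CK□⊢ φ → CK□⊢ (φ b⇒ ψ) → CK□⊢ ψ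
  bnec : ∀ {φ} → CK□⊢ φ → CK□⊢ (b□ φ)

{-# OPTIONS --safe #-}
module Submission where

open import Defs
open import Data.Product using (_×_; _,_)
open import Data.Nat using (ℕ)
open import Relation.Binary.PropositionalEquality using (_≡_; refl; cong; cong₂; subst)

-- Read ◇ as ⊤. This erasure fixes ◇-free formulas, commutes with substitution and
-- sends every axiom of CK, C◇ and I◇□ to a theorem of CK_□ (K◇ and C◇ become
-- trivial, I◇□ becomes (⊤ → □q) → □(p → q)), so it turns derivations in
-- CK ⊕ C◇ ⊕ I◇□ into derivations in CK_□. The converse inclusion holds because
-- every axiom of CK_□ is an axiom of CK.

⊤ : BFm
⊤ = b⊥ b⇒ b⊥

erase◇ : Fm → BFm
erase◇ (var n) = bvar n
erase◇ ⊥'      = b⊥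
erase◇ (a ∧ b) = erase◇ a b∧ erase◇ b
erase◇ (a ∨ b) = erase◇ a b∨ erase◇ b
erase◇ (a ⇒ b) = erase◇ a b⇒ erase◇ b
erase◇ (□ a)   = b□ (erase◇ a)
erase◇ (◇ a)   = ⊤

erase◇-sub : ∀ σ a → erase◇ (sub σ a) ≡ bsub (λ n → erase◇ (σ n)) (erase◇ a)
erase◇-sub σ (var n) = refl
erase◇-sub σ ⊥'      = refl
erase◇-sub σ (a ∧ b) = cong₂ _b∧_ (erase◇-sub σ a) (erase◇-sub σ b)
erase◇-sub σ (a ∨ b) = cong₂ _b∨_ (erase◇-sub σ a) (erase◇-sub σ b)
erase◇-sub σ (a ⇒ b) = cong₂ _b⇒_ (erase◇-sub σ a) (erase◇-sub σ b)
erase◇-sub σ (□ a)   = cong b□ (erase◇-sub σ a)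
erase◇-sub σ (◇ a)   = refl

erase◇-emb : ∀ φ → erase◇ (emb φ) ≡ φ
erase◇-emb (bvar n) = refl
erase◇-emb b⊥       = refl
erase◇-emb (a b∧ b) = cong₂ _b∧_ (erase◇-emb a) (erase◇-emb b)
erase◇-emb (a b∨ b) = cong₂ _b∨_ (erase◇-emb a) (erase◇-emb b)
erase◇-emb (a b⇒ b) = cong₂ _b⇒_ (erase◇-emb a) (erase◇-emb b)
erase◇-emb (b□ a)   = cong b□ (erase◇-emb a)

emb-bsub : ∀ σ a → emb (bsub σ a) ≡ sub (λ n → emb (σ n)) (emb a)
emb-bsub σ (bvar n) = refl
emb-bsub σ b⊥       = refl
emb-bsub σ (a b∧ b) = cong₂ _∧_ (emb-bsub σ a) (emb-bsub σ b)
emb-bsub σ (a b∨ b) = cong₂ _∨_ (emb-bsub σ a) (emb-bsub σ b)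
emb-bsub σ (a b⇒ b) = cong₂ _⇒_ (emb-bsub σ a) (emb-bsub σ b)
emb-bsub σ (b□ a)   = cong □ (emb-bsub σ a)

module CK□-DerivedRules where

  ⟨_,_,_⟩ : BFm → BFm → BFm → ℕ → BFm
  ⟨ A , B , C ⟩ 0 = A
  ⟨ A , B , C ⟩ 1 = B
  ⟨ A , B , C ⟩ _ = C

  weaken : ∀ {A B} → CK□⊢ B → CK□⊢ (A b⇒ B)
  weaken {A} {B} ⊢B = bmp ⊢B (bax ⟨ B , A , A ⟩ bax-K)

  mp-under : ∀ {A B C} → CK□⊢ (A b⇒ (B b⇒ C)) → CK□⊢ (A b⇒ B) → CK□⊢ (A b⇒ C)
  mp-under {A} {B} {C} ⊢A⇒B⇒C ⊢A⇒B = bmp ⊢A⇒B (bmp ⊢A⇒B⇒C (bax ⟨ A , B , C ⟩ bax-S))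

  ⇒-refl : ∀ A → CK□⊢ (A b⇒ A)
  ⇒-refl A = mp-under (bax ⟨ A , A b⇒ A , A ⟩ bax-K) (bax ⟨ A , A , A ⟩ bax-K)

  ⇒-trans : ∀ {A B C} → CK□⊢ (A b⇒ B) → CK□⊢ (B b⇒ C) → CK□⊢ (A b⇒ C)
  ⇒-trans ⊢A⇒B ⊢B⇒C = mp-under (weaken ⊢B⇒C) ⊢A⇒B

  ⊤-discharge : ∀ A → CK□⊢ ((⊤ b⇒ A) b⇒ A)
  ⊤-discharge A = mp-under (⇒-refl (⊤ b⇒ A)) (weaken (⇒-refl b⊥))

  □-weaken : ∀ A B → CK□⊢ (b□ B b⇒ b□ (A b⇒ B))
  □-weaken A B = bmp (bnec (bax ⟨ B , A , A ⟩ bax-K)) (bax ⟨ B , A b⇒ B , A ⟩ bax-K□)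

open CK□-DerivedRules

ErasesToCK□ : (Fm → Set) → Set
ErasesToCK□ Ax = (τ : ℕ → BFm) → ∀ {a} → Ax a → CK□⊢ (bsub τ (erase◇ a))

CKAx-erasesToCK□ : ErasesToCK□ CKAx
CKAx-erasesToCK□ τ (ipc ax-K)   = bax τ bax-K
CKAx-erasesToCK□ τ (ipc ax-S)   = bax τ bax-S
CKAx-erasesToCK□ τ (ipc ax-∧E₁) = bax τ bax-∧E₁
CKAx-erasesToCK□ τ (ipc ax-∧E₂) = bax τ bax-∧E₂
CKAx-erasesToCK□ τ (ipc ax-∧I)  = bax τ bax-∧I
CKAx-erasesToCK□ τ (ipc ax-∨I₁) = bax τ bax-∨I₁
CKAx-erasesToCK□ τ (ipc ax-∨I₂) = bax τ bax-∨I₂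
CKAx-erasesToCK□ τ (ipc ax-∨E)  = bax τ bax-∨E
CKAx-erasesToCK□ τ (ipc ax-efq) = bax τ bax-efq
CKAx-erasesToCK□ τ K□           = bax τ bax-K□
CKAx-erasesToCK□ τ K◇           = weaken (⇒-refl ⊤)

C◇+I◇□-erasesToCK□ : ErasesToCK□ C◇+I◇□
C◇+I◇□-erasesToCK□ τ isC◇  = bax ⟨ ⊤ , ⊤ , ⊤ ⟩ bax-∨I₁
C◇+I◇□-erasesToCK□ τ isI◇□ = ⇒-trans (⊤-discharge (b□ (τ 1))) (□-weaken (τ 0) (τ 1))

erase◇-instance : ∀ {Ax} → ErasesToCK□ Ax → (σ : ℕ → Fm) → ∀ {a} → Ax a → CK□⊢ (erase◇ (sub σ a))
erase◇-instance erases σ {a} ax rewrite erase◇-sub σ a = erases (λ n → erase◇ (σ n)) ax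

erase◇-sound : ∀ {Ax Γ φ} → ErasesToCK□ Ax → (∀ {ψ} → Γ ψ → CK□⊢ (erase◇ ψ)) →
               CK⊕ Ax Γ φ → CK□⊢ (erase◇ φ)
erase◇-sound erases hyps (axCK σ ax)  = erase◇-instance CKAx-erasesToCK□ σ ax
erase◇-sound erases hyps (axExt σ ax) = erase◇-instance erases σ ax
erase◇-sound erases hyps (el ψ∈Γ)     = hyps ψ∈Γ
erase◇-sound erases hyps (mp d e)     = bmp (erase◇-sound erases hyps d) (erase◇-sound erases hyps e)
erase◇-sound erases hyps (nec d)      = bnec (erase◇-sound erases (λ ()) d)

emb-CKBoxAx : ∀ {a} → CKBoxAx a → CKAx (emb a)
emb-CKBoxAx bax-K   = ipc ax-K
emb-CKBoxAx bax-S   = ipc ax-S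
emb-CKBoxAx bax-∧E₁ = ipc ax-∧E₁
emb-CKBoxAx bax-∧E₂ = ipc ax-∧E₂
emb-CKBoxAx bax-∧I  = ipc ax-∧I
emb-CKBoxAx bax-∨I₁ = ipc ax-∨I₁
emb-CKBoxAx bax-∨I₂ = ipc ax-∨I₂
emb-CKBoxAx bax-∨E  = ipc ax-∨E
emb-CKBoxAx bax-efq = ipc ax-efq
emb-CKBoxAx bax-K□  = K□

CK□⊢⇒CK⊕ : ∀ {Ax Γ φ} → CK□⊢ φ → CK⊕ Ax Γ (emb φ)
CK□⊢⇒CK⊕ (bax {a} σ ax) rewrite emb-bsub σ a = axCK _ (emb-CKBoxAx ax)
CK□⊢⇒CK⊕ (bmp d e)      = mp (CK□⊢⇒CK⊕ d) (CK□⊢⇒CK⊕ e)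
CK□⊢⇒CK⊕ (bnec d)       = nec (CK□⊢⇒CK⊕ d)

mainTheorem4 : (φ : BFm) → (CK⊕ C◇+I◇□ ∅ (emb φ) → CK□⊢ φ) × (CK□⊢ φ → CK⊕ C◇+I◇□ ∅ (emb φ))
mainTheorem4 φ = conservative , CK□⊢⇒CK⊕
  where
  conservative : CK⊕ C◇+I◇□ ∅ (emb φ) → CK□⊢ φ
  conservative d = subst CK□⊢ (erase◇-emb φ) (erase◇-sound C◇+I◇□-erasesToCK□ (λ ()) d)
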